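{- Let $\Gamma$ be an antipodal distance-regular graph with diameter $3$. Then a set $C$ of vertices of $\Gamma$ is a perfect $1$-code if and only if $C$ is a fiber of $\Gamma$.
   Context: A connected graph of diameter $d$ is distance-regular if for any two vertices $x,y$ at distance $i$ the number of neighbours of $x$ at distance $i+1$ (resp. $i-1$) from $y$ depends only on $i$. It is antipodal if the relation "equal or at distance $d$" is an equivalence relation; its classes are the fibers. A perfect $1$-code is a vertex subset $C$ such that the closed neighbourhoods of the vertices of $C$ partition the vertex set. -}

module Defs where

open import Data.Nat using (ℕ; zero; suc; _≤_)
open import Data.Bool using (Bool; true; false; _∧_; _∨_; not)
open import Data.Fin using (Fin)
open import Data.Fin.Properties using (_≟_)
open import Data.Fin.Subset using (Subset; _∈_)
open import Data.List.Base using (List; length; filterᵇ; allFin)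
open import Data.Bool.ListAction using (any)
open import Data.Product using (Σ; _×_; ∃; ∃-syntax)
open import Data.Sum using (_⊎_)
open import Relation.Nullary.Decidable using (⌊_⌋)
open import Relation.Binary.PropositionalEquality using (_≡_)
open import Relation.Binary.Structures using (IsEquivalence)
open import Function.Bundles using (_⇔_)

record Graph : Set where
  field
    n       : ℕ
    adj     : Fin n → Fin n → Bool
    adj-sym : ∀ x y → adj x y ≡ adj y x
    irrefl  : ∀ x → adj x x ≡ false

module _ (G : Graph) where
  open Graph G

  count : (Fin n → Bool) → ℕ
  count P = length (filterᵇ P (allFin n))

  -- reach k x y = true  iff  there is a walk of length ≤ k from x to y
  reach : ℕ → Fin n → Fin n → Bool
  reach zero    x y = ⌊ x ≟ y ⌋
  reach (suc k) x y = reach k x y ∨ any (λ z → adj x z ∧ reach k z y) (allFin n)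

  isDist : ℕ → Fin n → Fin n → Bool
  isDist zero    x y = reach zero x y
  isDist (suc i) x y = reach (suc i) x y ∧ not (reach i x y)

  Connected : Set
  Connected = ∀ x y → ∃[ i ] isDist i x y ≡ true

  HasDiameter : ℕ → Set
  HasDiameter d = Connected
                × (∀ x y → ∃[ i ] (i ≤ d × isDist i x y ≡ true))
                × ∃[ x ] ∃[ y ] isDist d x y ≡ true

  DistanceRegular : Set
  DistanceRegular =
      (∀ i → ∃[ b ] ∀ x y → isDist i x y ≡ true →
               count (λ z → adj x z ∧ isDist (suc i) z y) ≡ b)
    × (∀ i → ∃[ c ] ∀ x y → isDist (suc i) x y ≡ true →
               count (λ z → adj x z ∧ isDist i z y) ≡ c)

  Antip : ℕ → Fin n → Fin n → Set
  Antip d x y = x ≡ y ⊎ isDist d x y ≡ true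

  Antipodal : ℕ → Set
  Antipodal d = IsEquivalence (Antip d)

  IsFiber : ℕ → Subset n → Set
  IsFiber d C = ∃[ x ] ∀ y → (y ∈ C ⇔ Antip d x y)

  InClosedNbhd : Fin n → Fin n → Set
  InClosedNbhd c v = c ≡ v ⊎ adj c v ≡ true

  -- perfect 1-code: the closed neighbourhoods N[c], c ∈ C, partition V,
  -- i.e. every vertex lies in N[c] for exactly one c ∈ C
  PerfectCode : Subset n → Set
  PerfectCode C = ∀ v → ∃[ c ] (c ∈ C × InClosedNbhd c v
                     × (∀ c' → c' ∈ C → InClosedNbhd c' v → c' ≡ c))

-- In a graph of diameter 3, two vertices have intersecting closed neighbourhoods
-- exactly when they are at distance at most 2. So the codewords of a perfect code
-- are pairwise antipodal, and an antipode y of a codeword c is itself a codeword,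
-- since the codeword covering y is antipodal to c, hence to y, hence equal to y.
-- Conversely, antipodal vertices have disjoint closed neighbourhoods, and the fiber
-- of x covers every vertex v: if d(v,x) = 2 then, as b₂ ≠ 0 below the diameter,
-- v has a neighbour at distance 3 from x.
module Submission where

open import Defs
open import Data.Bool using (Bool; true; false; _∧_; not)
open import Data.Bool.ListAction using (any)
open import Data.Bool.Properties using (T-≡)
open import Data.Empty using (⊥-elim)
open import Data.Fin using (Fin)
open import Data.Fin.Properties using (_≟_)
open import Data.Fin.Subset using (Subset; _∈_)
open import Data.List.Base using (List; []; _∷_; length; filterᵇ; allFin)
open import Data.List.Membership.Propositional using (find; lose) renaming (_∈_ to _∈ₗ_)
open import Data.List.Membership.Propositional.Properties using (∈-allFin; ∈-filter⁺; ∈-filter⁻)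
open import Data.List.Relation.Unary.Any using (here; there)
open import Data.List.Relation.Unary.Any.Properties using (any⁺; any⁻)
open import Data.Nat using (ℕ; suc; s≤s)
open import Data.Product using (_×_; ∃-syntax; _,_; proj₁; proj₂)
open import Data.Sum using (_⊎_; inj₁; inj₂)
open import Function.Base using (_∘_)
open import Function.Bundles using (_⇔_; mk⇔; Equivalence)
open import Relation.Binary.PropositionalEquality using (_≡_; _≢_; refl; sym; trans; subst; cong)
open import Relation.Binary.Structures using (IsEquivalence)
open import Relation.Nullary using (¬_)
open import Relation.Nullary.Decidable using (dec-true; isYes≗does; T?; yes)

∧-true : ∀ {a b} → a ∧ b ≡ true → a ≡ true × b ≡ true
∧-true {true} {true} refl = refl , refl

∧-intro : ∀ {a b} → a ≡ true → b ≡ true → a ∧ b ≡ true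
∧-intro refl refl = refl

not-true : ∀ {a} → not a ≡ true → a ≡ false
not-true {false} refl = refl

true≢false : ∀ {a} → a ≡ true → a ≢ false
true≢false refl ()

any-allFin⁻ : ∀ {n} (p : Fin n → Bool) → any p (allFin n) ≡ true → ∃[ x ] p x ≡ true
any-allFin⁻ p e
  with x , _ , px ← find (any⁻ p (allFin _) (Equivalence.from T-≡ e)) = x , Equivalence.to T-≡ px

any-allFin⁺ : ∀ {n} (p : Fin n → Bool) {x} → p x ≡ true → any p (allFin n) ≡ true
any-allFin⁺ p {x} px = Equivalence.to T-≡ (any⁺ p (lose (∈-allFin x) (Equivalence.from T-≡ px)))

length≢0 : ∀ {A : Set} {x} {xs : List A} → x ∈ₗ xs → length xs ≢ 0
length≢0 (here _)  ()
length≢0 (there _) ()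

filterᵇ-allFin-length≢0⁺ : ∀ {n} (p : Fin n → Bool) {x} → p x ≡ true → length (filterᵇ p (allFin n)) ≢ 0
filterᵇ-allFin-length≢0⁺ p {x} px =
  length≢0 (∈-filter⁺ (T? ∘ p) (∈-allFin x) (Equivalence.from T-≡ px))

filterᵇ-allFin-length≢0⁻ : ∀ {n} (p : Fin n → Bool) → length (filterᵇ p (allFin n)) ≢ 0 → ∃[ x ] p x ≡ true
filterᵇ-allFin-length≢0⁻ {n} p nonempty with filterᵇ p (allFin _) in eq
... | [] = ⊥-elim (nonempty refl)
... | x ∷ _ = x , Equivalence.to T-≡ (proj₂ (∈-filter⁻ (T? ∘ p) {xs = allFin n} x∈filter))
  where
  x∈filter : x ∈ₗ filterᵇ p (allFin n)
  x∈filter = subst (x ∈ₗ_) (sym eq) (here refl)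

module _ (G : Graph) where
  open Graph G

  InClosedNbhd-sym : ∀ {x y} → InClosedNbhd G x y → InClosedNbhd G y x
  InClosedNbhd-sym (inj₁ refl) = inj₁ refl
  InClosedNbhd-sym {x} {y} (inj₂ a) = inj₂ (trans (adj-sym y x) a)

  reach0⇒≡ : ∀ {x y} → reach G 0 x y ≡ true → x ≡ y
  reach0⇒≡ {x} {y} e with x ≟ y
  ... | yes x≡y = x≡y

  reach0-refl : ∀ x → reach G 0 x x ≡ true
  reach0-refl x = trans (isYes≗does (x ≟ x)) (dec-true (x ≟ x) refl)

  reach-suc : ∀ k {x y} → reach G k x y ≡ true → reach G (suc k) x y ≡ true
  reach-suc k e rewrite e = refl

  reach-step : ∀ k {x z y} → adj x z ≡ true → reach G k z y ≡ true → reach G (suc k) x y ≡ true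
  reach-step k {x} {z} {y} a r with reach G k x y
  ... | true  = refl
  ... | false = any-allFin⁺ (λ w → adj x w ∧ reach G k w y) (∧-intro a r)

  reach-suc⁻ : ∀ k {x y} → reach G (suc k) x y ≡ true →
               reach G k x y ≡ true ⊎ ∃[ z ] (adj x z ≡ true × reach G k z y ≡ true)
  reach-suc⁻ k {x} {y} e with reach G k x y
  ... | true  = inj₁ refl
  ... | false with z , e′ ← any-allFin⁻ (λ w → adj x w ∧ reach G k w y) e = inj₂ (z , ∧-true e′)

  reach1⇔InClosedNbhd : ∀ {x y} → reach G 1 x y ≡ true ⇔ InClosedNbhd G x y
  reach1⇔InClosedNbhd = mk⇔ to from
    where
    to : ∀ {x y} → reach G 1 x y ≡ true → InClosedNbhd G x y
    to e with reach-suc⁻ 0 e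
    ... | inj₁ r = inj₁ (reach0⇒≡ r)
    ... | inj₂ (z , a , r) with refl ← reach0⇒≡ r = inj₂ a
    from : ∀ {x y} → InClosedNbhd G x y → reach G 1 x y ≡ true
    from {x} (inj₁ refl) = reach-suc 0 (reach0-refl x)
    from {y = y} (inj₂ a) = reach-step 0 a (reach0-refl y)

  CommonClosedNbhd : Fin n → Fin n → Set
  CommonClosedNbhd x y = ∃[ v ] (InClosedNbhd G x v × InClosedNbhd G y v)

  reach2⇔CommonClosedNbhd : ∀ {x y} → reach G 2 x y ≡ true ⇔ CommonClosedNbhd x y
  reach2⇔CommonClosedNbhd = mk⇔ to from
    where
    nbhd : ∀ {x y} → reach G 1 x y ≡ true → InClosedNbhd G x y
    nbhd = Equivalence.to reach1⇔InClosedNbhd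
    reach1 : ∀ {x y} → InClosedNbhd G x y → reach G 1 x y ≡ true
    reach1 = Equivalence.from reach1⇔InClosedNbhd
    to : ∀ {x y} → reach G 2 x y ≡ true → CommonClosedNbhd x y
    to {y = y} e with reach-suc⁻ 1 e
    ... | inj₁ r           = y , nbhd r , inj₁ refl
    ... | inj₂ (z , a , r) = z , inj₂ a , InClosedNbhd-sym (nbhd r)
    from : ∀ {x y} → CommonClosedNbhd x y → reach G 2 x y ≡ true
    from (v , inj₁ refl , q) = reach-suc 1 (reach1 (InClosedNbhd-sym q))
    from (v , inj₂ a , q)    = reach-step 1 a (reach1 (InClosedNbhd-sym q))

  dist3⇒¬CommonClosedNbhd : ∀ {x y} → isDist G 3 x y ≡ true → ¬ CommonClosedNbhd x y
  dist3⇒¬CommonClosedNbhd e common =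
    true≢false (Equivalence.from reach2⇔CommonClosedNbhd common) (not-true (proj₂ (∧-true e)))

  dist-pred : ∀ i {x y} → isDist G (suc (suc i)) x y ≡ true →
              ∃[ u ] (adj x u ≡ true × isDist G (suc i) u y ≡ true)
  dist-pred i {x} {y} e with reach-suc⁻ (suc i) (proj₁ (∧-true e))
  ... | inj₁ r = ⊥-elim (true≢false r (not-true (proj₂ (∧-true e))))
  ... | inj₂ (u , a , r) = u , a , ∧-intro r (cong not u-not-closer)
    where
    u-not-closer : reach G i u y ≡ false
    u-not-closer with reach G i u y in eq
    ... | false = refl
    ... | true  = ⊥-elim (true≢false (reach-step i a eq) (not-true (proj₂ (∧-true e))))

  reach2⊎dist3 : HasDiameter G 3 → ∀ x y → reach G 2 x y ≡ true ⊎ isDist G 3 x y ≡ true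
  reach2⊎dist3 (_ , within , _) x y with within x y
  ... | 0 , _ , e = inj₁ (reach-suc 1 (reach-suc 0 e))
  ... | 1 , _ , e = inj₁ (reach-suc 1 (proj₁ (∧-true e)))
  ... | 2 , _ , e = inj₁ (proj₁ (∧-true e))
  ... | 3 , _ , e = inj₂ e
  ... | suc (suc (suc (suc _))) , s≤s (s≤s (s≤s ())) , _

  module _ (dr : DistanceRegular G) where

    b : ℕ → ℕ
    b i = proj₁ (proj₁ dr i)

    b≢0 : ∀ i → (∃[ x ] ∃[ y ] isDist G (suc (suc i)) x y ≡ true) → b (suc i) ≢ 0
    b≢0 i (x , y , e) with u , a , r ← dist-pred i e =
      subst (_≢ 0) (proj₂ (proj₁ dr (suc i)) u y r)
        (filterᵇ-allFin-length≢0⁺ (λ w → adj u w ∧ isDist G (suc (suc i)) w y)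
                                  (∧-intro (trans (adj-sym u x) a) e))

    further-neighbour : ∀ i → (∃[ x ] ∃[ y ] isDist G (suc (suc i)) x y ≡ true) →
                        ∀ {v x} → isDist G (suc i) v x ≡ true →
                        ∃[ z ] (adj v z ≡ true × isDist G (suc (suc i)) z x ≡ true)
    further-neighbour i far {v} {x} e
      with z , found ← filterᵇ-allFin-length≢0⁻ (λ w → adj v w ∧ isDist G (suc (suc i)) w x)
                         (subst (_≢ 0) (sym (proj₂ (proj₁ dr (suc i)) v x e)) (b≢0 i far))
      = z , ∧-true found

  Antip-CommonClosedNbhd⇒≡ : ∀ {x y} → Antip G 3 x y → CommonClosedNbhd x y → x ≡ y
  Antip-CommonClosedNbhd⇒≡ (inj₁ x≡y) _      = x≡y
  Antip-CommonClosedNbhd⇒≡ (inj₂ e)   common = ⊥-elim (dist3⇒¬CommonClosedNbhd e common)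

  PerfectCode-CommonClosedNbhd⇒≡ : ∀ {C c c′} → PerfectCode G C → c ∈ C → c′ ∈ C →
                                   CommonClosedNbhd c c′ → c ≡ c′
  PerfectCode-CommonClosedNbhd⇒≡ code c∈C c′∈C (v , p , p′)
    with _ , _ , _ , unique ← code v = trans (unique _ c∈C p) (sym (unique _ c′∈C p′))

  module _ (diam : HasDiameter G 3) (ant : Antipodal G 3) where

    Antip-sym : ∀ {x y} → Antip G 3 x y → Antip G 3 y x
    Antip-sym = IsEquivalence.sym ant

    Antip-trans : ∀ {x y z} → Antip G 3 x y → Antip G 3 y z → Antip G 3 x z
    Antip-trans = IsEquivalence.trans ant

    module _ {C : Subset n} (code : PerfectCode G C) where

      codewords-Antip : ∀ {c c′} → c ∈ C → c′ ∈ C → Antip G 3 c c′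
      codewords-Antip {c} {c′} c∈C c′∈C with reach2⊎dist3 diam c c′
      ... | inj₁ r = inj₁ (PerfectCode-CommonClosedNbhd⇒≡ code c∈C c′∈C
                             (Equivalence.to reach2⇔CommonClosedNbhd r))
      ... | inj₂ e = inj₂ e

      Antip-codeword⇒codeword : ∀ {c y} → c ∈ C → Antip G 3 c y → y ∈ C
      Antip-codeword⇒codeword {c} {y} c∈C cy with c′ , c′∈C , covers , _ ← code y =
        subst (_∈ C) c′≡y c′∈C
        where
        c′≡y : c′ ≡ y
        c′≡y = Antip-CommonClosedNbhd⇒≡ (Antip-trans (Antip-sym (codewords-Antip c∈C c′∈C)) cy)
                                         (y , covers , inj₁ refl)

      PerfectCode⇒IsFiber : IsFiber G 3 C
      PerfectCode⇒IsFiber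
        with x , _ ← proj₂ (proj₂ diam)
        with c , c∈C , _ ← code x
        = c , λ y → mk⇔ (codewords-Antip c∈C) (Antip-codeword⇒codeword c∈C)

    module _ (dr : DistanceRegular G) where

      Antip-covers : ∀ x v → ∃[ c ] (Antip G 3 x c × InClosedNbhd G c v)
      Antip-covers x v with reach G 1 v x in eq
      ... | true = x , inj₁ refl , InClosedNbhd-sym (Equivalence.to reach1⇔InClosedNbhd eq)
      ... | false with reach2⊎dist3 diam v x
      ...   | inj₂ e = v , Antip-sym (inj₂ e) , inj₁ refl
      ...   | inj₁ r
              with z , a , e ← further-neighbour dr 1 (proj₂ (proj₂ diam)) (∧-intro r (cong not eq))
              = z , Antip-sym (inj₂ e) , InClosedNbhd-sym (inj₂ a)

      IsFiber⇒PerfectCode : ∀ {C} → IsFiber G 3 C → PerfectCode G C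
      IsFiber⇒PerfectCode (x , fiber) v with c , xc , covers ← Antip-covers x v =
        c , Equivalence.from (fiber c) xc , covers ,
        λ c′ c′∈C covers′ →
          Antip-CommonClosedNbhd⇒≡ (Antip-trans (Antip-sym (Equivalence.to (fiber c′) c′∈C)) xc)
                                   (v , covers′ , covers)

corollary3p2 : (G : Graph) → DistanceRegular G → HasDiameter G 3 → Antipodal G 3
    → (C : Subset (Graph.n G)) → PerfectCode G C ⇔ IsFiber G 3 C
corollary3p2 G dr diam ant C =
  mk⇔ (PerfectCode⇒IsFiber G diam ant) (IsFiber⇒PerfectCode G diam ant dr)
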